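{- Let $n\geq 1$ and $N\geq 2$. Let $z^1\in\{0,\frac1N,\dots,1\}^n$ and $I=\{i : z^1_i=0 \text{ or } z^1_i=1\}$. Start from the packing consisting of the single cube $z^1+[0,1]^n$ in $[0,2]^n$ and continue the sequential random discrete cube packing process until no cube can be added. Then: (i) the minimal possible number of cubes in the resulting packing is $|I|+1$; (ii) the expected number of cubes in the resulting packing is $|I|+1+O\left(\frac{1}{N+1}\right)$ as $N\to\infty$.
   Context: Cubes considered are $z+[0,1]^n$ with $z\in\{0,\frac1N,\dots,1\}^n$ (so they lie in $[0,2]^n$). Two such cubes $z+[0,1]^n$, $z'+[0,1]^n$ are non-overlapping iff there is an index $i$ with $\{z_i,z'_i\}=\{0,1\}$. The sequential random discrete cube packing process repeatedly adds a cube chosen uniformly at random among all cubes $z+[0,1]^n$, $z\in\{0,\frac1N,\dots,1\}^n$, not overlapping the cubes already placed, until no such cube exists. -}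

module Defs where

open import Data.Nat as ℕ using (ℕ; zero; suc)
open import Data.Fin using (Fin; fromℕ) renaming (zero to fzero)
open import Data.Fin.Properties as FinP using (any?; all?)
open import Data.Vec using (Vec; []; _∷_; lookup)
open import Data.List as List using (List; []; _∷_; length; map; filter; concatMap; allFin)
open import Data.List.Relation.Unary.All as All using (All)
open import Data.Product using (Σ; ∃-syntax; _×_; _,_)
open import Data.Sum using (_⊎_)
open import Relation.Nullary using (¬_; Dec)
open import Relation.Nullary.Decidable using (_×-dec_; _⊎-dec_)
open import Relation.Binary.PropositionalEquality using (_≡_)
open import Data.Integer using (+_)
open import Data.Rational as ℚ using (ℚ)

-- A cube z + [0,1]^n with z ∈ {0, 1/N, ..., 1}^n is encoded by the vector
-- of numerators k ∈ {0,...,N}^n, i.e. z_i = k_i / N.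
Cube : ℕ → ℕ → Set
Cube N n = Vec (Fin (suc N)) n

Extreme : ∀ {N} → Fin (suc N) → Fin (suc N) → Set
Extreme {N} a b = (a ≡ fzero × b ≡ fromℕ N) ⊎ (a ≡ fromℕ N × b ≡ fzero)

extreme? : ∀ {N} (a b : Fin (suc N)) → Dec (Extreme a b)
extreme? {N} a b =
  ((a FinP.≟ fzero) ×-dec (b FinP.≟ fromℕ N)) ⊎-dec ((a FinP.≟ fromℕ N) ×-dec (b FinP.≟ fzero))

NonOverlapping : ∀ {N n} → Cube N n → Cube N n → Set
NonOverlapping {N} {n} z z' = ∃[ i ] Extreme (lookup z i) (lookup z' i)

nonOverlapping? : ∀ {N n} (z z' : Cube N n) → Dec (NonOverlapping z z')
nonOverlapping? z z' = any? (λ i → extreme? (lookup z i) (lookup z' i))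

-- A packing: the list of cubes placed so far (most recent first).
Packing : ℕ → ℕ → Set
Packing N n = List (Cube N n)

Addable : ∀ {N n} → Packing N n → Cube N n → Set
Addable P z = All (NonOverlapping z) P

addable? : ∀ {N n} (P : Packing N n) (z : Cube N n) → Dec (Addable P z)
addable? P z = All.all? (nonOverlapping? z) P

Maximal : ∀ {N n} → Packing N n → Set
Maximal P = ∀ z → ¬ Addable P z

-- Completion P Q: Q is a possible final packing of the process started at P
-- (every addition of an allowed cube has positive probability).
data Completion {N n : ℕ} : Packing N n → Packing N n → Set where
  done : ∀ {P} → Maximal P → Completion P P
  step : ∀ {P Q} z → Addable P z → Completion (z ∷ P) Q → Completion P Q

allVecs : (N n : ℕ) → List (Cube N n)
allVecs N zero = [] ∷ []
allVecs N (suc n) = concatMap (λ k → map (k ∷_) (allVecs N n)) (allFin (suc N))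

available : ∀ {N n} → Packing N n → List (Cube N n)
available {N} {n} P = filter (addable? P) (allVecs N n)

sumℚ : List ℚ → ℚ
sumℚ = List.foldr ℚ._+_ ℚ.0ℚ

lengthℚ : ∀ {A : Set} → List A → ℚ
lengthℚ xs = (+ length xs) ℚ./ 1

-- Expected final number of cubes when the process is run from P, with
-- a fuel parameter (each step removes at least the chosen cube from the
-- available list, so fuel ≥ |available P| suffices).
expectedFuel : ∀ {N n} → ℕ → Packing N n → ℚ
expectedFuel zero P = lengthℚ P
expectedFuel (suc f) P with available P
... | [] = lengthℚ P
... | z ∷ zs = sumℚ (map (λ w → expectedFuel f (w ∷ P)) (z ∷ zs)) ℚ.* ((+ 1) ℚ./ suc (length zs))

-- Expected number of cubes in the final packing of the process started
-- from the packing P (fuel (N+1)^n is enough: there are (N+1)^n cubes).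
expected : ∀ {N n} → Packing N n → ℚ
expected {N} {n} P = expectedFuel ((suc N) ℕ.^ n) P

Iset : ∀ {N n} → Cube N n → List (Fin n)
Iset {N} {n} z = filter (λ i → (lookup z i FinP.≟ fzero) ⊎-dec (lookup z i FinP.≟ fromℕ N)) (allFin n)

module Submission where

-- (i) In a maximal packing, for each i ∈ I the cube z with coordinate i flipped
-- to the other side must overlap a placed cube, and such a cube is separated
-- from z exactly in coordinate i; so besides z at least |I| cubes are placed.
-- A greedy completion (flip one unused i ∈ I, put 1/N elsewhere) attains |I| + 1.
-- (ii) Along the process there is a set P ⊆ I of used coordinates such that the
-- addable cubes are exactly those separated from z that agree with z on P.  A
-- cube with one extreme coordinate outside P uses up one coordinate; cubes with
-- two are a fraction ≤ n² 6^n/(N + 1) of the available ones (compared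
-- coordinatewise with interior cubes) and afterwards at most 2^n cubes fit.
-- Induction on the process gives |I| + 1 ≤ E ≤ |I| + 1 + n · 2^n n² 6^n/(N + 1).

module ListCount where

  open import Data.Nat using (ℕ; suc; _≤_; _<_; _+_; _*_; z≤n; s≤s)
  open import Data.Nat.Properties
  open import Data.Nat.ListAction using (sum)
  open import Data.List using (List; []; _∷_; length; map; filter; _++_)
  open import Data.List.Properties using (filter-accept; filter-reject; filter-++; filter-none; filter-≐; length-++; length-filter)
  open import Data.List.Relation.Unary.All as All using (All; []; _∷_)
  open import Data.List.Relation.Unary.Any as Any using (Any; here; there)
  open import Data.List.Relation.Unary.AllPairs using (AllPairs; []; _∷_)
  open import Data.List.Membership.Propositional using (_∈_)
  open import Data.List.Membership.Propositional.Properties using (∈-filter⁺; ∈-length; ∈-∃++; ∈-++⁻; ∈-++⁺ˡ; ∈-++⁺ʳ)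
  open import Data.List.Relation.Binary.Sublist.Propositional using (_∷ʳ_; ⊆-refl)
  open import Data.List.Relation.Binary.Sublist.Propositional.Properties using (filter⁺; filter-⊆; length-mono-≤)
  open import Data.Product using (_,_)
  open import Data.Sum using (inj₁; inj₂)
  open import Relation.Nullary using (¬_; Dec; yes; no; contradiction)
  open import Relation.Nullary.Decidable using (¬?)
  open import Relation.Unary using (Pred; Decidable)
  open import Relation.Binary.PropositionalEquality using (_≡_; refl; sym; trans; cong; cong₂)
  open import Level using (0ℓ)

  module _ {B : Set} where

    sum-mono : ∀ (J : List B) {f g : B → ℕ} → (∀ j → f j ≤ g j) →
      sum (map f J) ≤ sum (map g J)
    sum-mono []      f≤g = z≤n
    sum-mono (j ∷ J) f≤g = +-mono-≤ (f≤g j) (sum-mono J f≤g)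

    sum-strict : ∀ {J : List B} {f g : B → ℕ} → (∀ j → f j ≤ g j) →
      Any (λ j → f j < g j) J → sum (map f J) < sum (map g J)
    sum-strict {j ∷ J} f≤g (here f<g)  = +-mono-<-≤ f<g (sum-mono J f≤g)
    sum-strict {j ∷ J} f≤g (there any) = +-mono-≤-< (f≤g j) (sum-strict f≤g any)

    sum-bound : ∀ (J : List B) (g : B → ℕ) a b → (∀ j → a * g j ≤ b) →
      a * sum (map g J) ≤ length J * b
    sum-bound []      g a b h = ≤-reflexive (*-zeroʳ a)
    sum-bound (j ∷ J) g a b h = begin
      a * (g j + sum (map g J))      ≡⟨ *-distribˡ-+ a (g j) _ ⟩
      a * g j + a * sum (map g J)    ≤⟨ +-mono-≤ (h j) (sum-bound J g a b h) ⟩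
      b + length J * b               ∎
      where open ≤-Reasoning

  module _ {A : Set} where

    count : {P : Pred A 0ℓ} → Decidable P → List A → ℕ
    count P? xs = length (filter P? xs)

    count-≤-length : {P : Pred A 0ℓ} (P? : Decidable P) → ∀ xs → count P? xs ≤ length xs
    count-≤-length P? = length-filter P?

    count-mono : {P Q : Pred A 0ℓ} (P? : Decidable P) (Q? : Decidable Q) →
      (∀ {x} → P x → Q x) → ∀ xs → count P? xs ≤ count Q? xs
    count-mono P? Q? P⇒Q xs = length-mono-≤ (filter⁺ P? Q? (λ { refl → P⇒Q }) (⊆-refl {x = xs}))

    count-filter : {P Q : Pred A 0ℓ} (P? : Decidable P) (Q? : Decidable Q) →
      ∀ xs → count Q? (filter P? xs) ≤ count Q? xs
    count-filter P? Q? xs = length-mono-≤ (filter⁺ Q? Q? (λ { refl q → q }) (filter-⊆ P? xs))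

    count-cong : {P Q : Pred A 0ℓ} (P? : Decidable P) (Q? : Decidable Q) →
      (∀ {x} → P x → Q x) → (∀ {x} → Q x → P x) → ∀ xs → count P? xs ≡ count Q? xs
    count-cong P? Q? P⇒Q Q⇒P xs = cong length (filter-≐ P? Q? (P⇒Q , Q⇒P) xs)

    count-none : {P : Pred A 0ℓ} (P? : Decidable P) → (∀ x → ¬ P x) → ∀ xs → count P? xs ≡ 0
    count-none P? ¬P xs = cong length (filter-none P? {xs = xs} (All.tabulate (λ {x} _ → ¬P x)))

    count-pos : {P : Pred A 0ℓ} (P? : Decidable P) → ∀ {y xs} → y ∈ xs → P y → 0 < count P? xs
    count-pos P? y∈xs py = ∈-length (∈-filter⁺ P? y∈xs py)

    count-∷ : {P : Pred A 0ℓ} (P? : Decidable P) → ∀ x xs → count P? xs ≤ count P? (x ∷ xs)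
    count-∷ P? x xs = length-mono-≤ (filter⁺ P? P? (λ { refl p → p }) (x ∷ʳ ⊆-refl {x = xs}))

    count-∷-accept : {P : Pred A 0ℓ} (P? : Decidable P) → ∀ {x} xs → P x → count P? xs < count P? (x ∷ xs)
    count-∷-accept P? xs px = ≤-reflexive (sym (cong length (filter-accept P? {xs = xs} px)))

    count-strict : {P Q : Pred A 0ℓ} (P? : Decidable P) (Q? : Decidable Q) →
      (∀ {x} → P x → Q x) → ∀ {y xs} → y ∈ xs → Q y → ¬ P y → count P? xs < count Q? xs
    count-strict P? Q? P⇒Q {y} {y ∷ xs} (here refl) qy ¬py = begin-strict
      count P? (y ∷ xs)  ≡⟨ cong length (filter-reject P? {xs = xs} ¬py) ⟩
      count P? xs        ≤⟨ count-mono P? Q? P⇒Q xs ⟩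
      count Q? xs        <⟨ count-∷-accept Q? xs qy ⟩
      count Q? (y ∷ xs)  ∎
      where open ≤-Reasoning
    count-strict P? Q? P⇒Q {xs = x ∷ xs} (there y∈xs) qy ¬py with P? x | Q? x
    ... | yes _  | yes _  = s≤s (count-strict P? Q? P⇒Q y∈xs qy ¬py)
    ... | yes px | no ¬qx = contradiction (P⇒Q px) ¬qx
    ... | no _   | yes _  = m≤n⇒m≤1+n (count-strict P? Q? P⇒Q y∈xs qy ¬py)
    ... | no _   | no _   = count-strict P? Q? P⇒Q y∈xs qy ¬py

    count-++ : {P : Pred A 0ℓ} (P? : Decidable P) → ∀ xs ys → count P? (xs ++ ys) ≡ count P? xs + count P? ys
    count-++ P? xs ys = trans (cong length (filter-++ P? xs ys)) (length-++ (filter P? xs))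

    count-complement : {P : Pred A 0ℓ} (P? : Decidable P) → ∀ xs →
      count P? xs + count (λ x → ¬? (P? x)) xs ≡ length xs
    count-complement P? []       = refl
    count-complement P? (x ∷ xs) with P? x
    ... | yes _ = cong suc (count-complement P? xs)
    ... | no  _ = trans (+-suc _ _) (cong suc (count-complement P? xs))

    count-unique : (_≟_ : ∀ (a b : A) → Dec (a ≡ b)) → ∀ y xs → AllPairs (λ a b → ¬ a ≡ b) xs →
      count (λ x → x ≟ y) xs ≤ 1
    count-unique _≟_ y []       []         = z≤n
    count-unique _≟_ y (x ∷ xs) (x∉ ∷ uniq) with x ≟ y
    ... | no  _    = count-unique _≟_ y xs uniq
    ... | yes refl = s≤s (≤-reflexive (none xs x∉))
      where
      none : ∀ zs → All (λ b → ¬ y ≡ b) zs → count (λ x → x ≟ y) zs ≡ 0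
      none []       []           = refl
      none (b ∷ zs) (y≢b ∷ y≢zs) with b ≟ y
      ... | yes b≡y = contradiction (sym b≡y) y≢b
      ... | no  _   = none zs y≢zs

    module _ {B : Set} {P : Pred A 0ℓ} (P? : Decidable P) {Q : B → Pred A 0ℓ}
             (Q? : ∀ j → Decidable (Q j)) (J : List B) where

      union-bound : ∀ xs → All (λ x → P x → Any (λ j → Q j x) J) xs →
        count P? xs ≤ sum (map (λ j → count (Q? j) xs) J)
      union-bound []       []       = z≤n
      union-bound (x ∷ xs) (h ∷ hs) with P? x
      ... | no  _  = ≤-trans (union-bound xs hs) (sum-mono J (λ j → count-∷ (Q? j) x xs))
      ... | yes px = ≤-trans (s≤s (union-bound xs hs))
                       (sum-strict (λ j → count-∷ (Q? j) x xs) (Any.map (count-∷-accept (Q? _) xs) (h px)))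

  module _ {A C : Set} where

    count-map : {P : Pred C 0ℓ} (P? : Decidable P) (f : A → C) → ∀ xs →
      count P? (map f xs) ≡ count (λ x → P? (f x)) xs
    count-map P? f []       = refl
    count-map P? f (x ∷ xs) with P? (f x)
    ... | yes _ = cong suc (count-map P? f xs)
    ... | no  _ = count-map P? f xs

  allPairs-restrict : ∀ {A : Set} {P : Pred A 0ℓ} {R R′ : A → A → Set} →
    (∀ {x y} → P x → P y → R x y → R′ x y) → ∀ {xs} → All P xs → AllPairs R xs → AllPairs R′ xs
  allPairs-restrict f []         []         = []
  allPairs-restrict f (px ∷ pxs) (rx ∷ rxs) = All.zipWith (λ (py , r) → f px py r) (pxs , rx) ∷ allPairs-restrict f pxs rxs

  unique-⊆-length : ∀ {A : Set} {xs ys : List A} → AllPairs (λ a b → ¬ a ≡ b) xs →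
    (∀ {x} → x ∈ xs → x ∈ ys) → length xs ≤ length ys
  unique-⊆-length {xs = []}     []           xs⊆ys = z≤n
  unique-⊆-length {xs = x ∷ xs} (x∉ ∷ uniq) xs⊆ys with ∈-∃++ (xs⊆ys (here refl))
  ... | ys₁ , ys₂ , refl = begin
    suc (length xs)                ≤⟨ s≤s (unique-⊆-length uniq rest⊆) ⟩
    suc (length (ys₁ ++ ys₂))      ≡⟨ cong suc (length-++ ys₁) ⟩
    suc (length ys₁ + length ys₂)  ≡⟨ sym (+-suc (length ys₁) (length ys₂)) ⟩
    length ys₁ + length (x ∷ ys₂)  ≡⟨ sym (length-++ ys₁) ⟩
    length (ys₁ ++ x ∷ ys₂)        ∎
    where
    open ≤-Reasoning
    rest⊆ : ∀ {y} → y ∈ xs → y ∈ ys₁ ++ ys₂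
    rest⊆ {y} y∈xs with ∈-++⁻ ys₁ (xs⊆ys (there y∈xs))
    ... | inj₁ y∈ys₁           = ∈-++⁺ˡ y∈ys₁
    ... | inj₂ (here refl)     = contradiction refl (All.lookup x∉ y∈xs)
    ... | inj₂ (there y∈ys₂)   = ∈-++⁺ʳ ys₁ y∈ys₂

module RationalArith where

  open import Data.Nat as ℕ using (ℕ; suc; z≤n)
  open import Data.Integer as ℤ using ()
  import Data.Integer.Properties as ℤP
  open import Data.Rational as ℚ using (ℚ; _/_; toℚᵘ; _+_; _*_; _-_; _≤_; 0ℚ; 1ℚ; ∣_∣)
  open import Data.Rational.Properties
  open import Data.Rational.Unnormalised as ℚᵘ using (ℚᵘ; mkℚᵘ; *≡*; *≤*)
  import Data.Rational.Unnormalised.Properties as ℚᵘP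
  open import Data.List using (List; []; _∷_; length; map; filter)
  open import Data.List.Relation.Unary.All using (All; []; _∷_)
  open import Data.Product using (_×_; _,_)
  open import Relation.Nullary using (¬_; yes; no)
  open import Relation.Unary using (Pred; Decidable)
  open import Relation.Binary.PropositionalEquality using (_≡_; sym; trans; cong; cong₂; module ≡-Reasoning)
  open import Level using (0ℓ)
  import Relation.Binary.Reasoning.Setoid
  open import Defs using (sumℚ)

  -- The embedding ℕ → ℚ, in the form m / 1 used by the statement.
  ι : ℕ → ℚ
  ι m = (ℤ.+ m) / 1

  inv : ℕ → ℚ
  inv m = (ℤ.+ 1) / suc m

  -- The image of ι in the unnormalised rationals, where computation is easy.
  private
    ιᵘ : ℕ → ℚᵘ
    ιᵘ m = mkℚᵘ (ℤ.+ m) 0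

    ι≃ : ∀ m → toℚᵘ (ι m) ℚᵘ.≃ ιᵘ m
    ι≃ m = toℚᵘ-fromℚᵘ (ιᵘ m)

    inv≃ : ∀ m → toℚᵘ (inv m) ℚᵘ.≃ mkℚᵘ (ℤ.+ 1) m
    inv≃ m = toℚᵘ-fromℚᵘ (mkℚᵘ (ℤ.+ 1) m)

    module ≃-Reasoning = Relation.Binary.Reasoning.Setoid ℚᵘP.≃-setoid

  ι-+ : ∀ a b → ι (a ℕ.+ b) ≡ ι a + ι b
  ι-+ a b = toℚᵘ-injective (begin
    toℚᵘ (ι (a ℕ.+ b))          ≈⟨ ι≃ (a ℕ.+ b) ⟩
    ιᵘ (a ℕ.+ b)                ≈⟨ ℚᵘP.≃-sym (*≡* (ℤ-sum a b)) ⟩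
    ιᵘ a ℚᵘ.+ ιᵘ b              ≈⟨ ℚᵘP.+-cong (ℚᵘP.≃-sym (ι≃ a)) (ℚᵘP.≃-sym (ι≃ b)) ⟩
    toℚᵘ (ι a) ℚᵘ.+ toℚᵘ (ι b)  ≈⟨ ℚᵘP.≃-sym (toℚᵘ-homo-+ (ι a) (ι b)) ⟩
    toℚᵘ (ι a + ι b)            ∎)
    where
    open ≃-Reasoning
    ℤ-sum : ∀ a b → (ℤ.+ a ℤ.* ℤ.+ 1 ℤ.+ ℤ.+ b ℤ.* ℤ.+ 1) ℤ.* ℤ.+ 1 ≡ ℤ.+ (a ℕ.+ b) ℤ.* ℤ.+ 1
    ℤ-sum a b rewrite ℤP.*-identityʳ (ℤ.+ a) | ℤP.*-identityʳ (ℤ.+ b) = cong (ℤ._* ℤ.+ 1) (sym (ℤP.pos-+ a b))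

  ι-* : ∀ a b → ι (a ℕ.* b) ≡ ι a * ι b
  ι-* a b = toℚᵘ-injective (begin
    toℚᵘ (ι (a ℕ.* b))          ≈⟨ ι≃ (a ℕ.* b) ⟩
    ιᵘ (a ℕ.* b)                ≈⟨ ℚᵘP.≃-sym (*≡* (cong (ℤ._* ℤ.+ 1) (sym (ℤP.pos-* a b)))) ⟩
    ιᵘ a ℚᵘ.* ιᵘ b              ≈⟨ ℚᵘP.*-cong (ℚᵘP.≃-sym (ι≃ a)) (ℚᵘP.≃-sym (ι≃ b)) ⟩
    toℚᵘ (ι a) ℚᵘ.* toℚᵘ (ι b)  ≈⟨ ℚᵘP.≃-sym (toℚᵘ-homo-* (ι a) (ι b)) ⟩
    toℚᵘ (ι a * ι b)            ∎)
    where open ≃-Reasoning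

  ι-mono : ∀ {a b} → a ℕ.≤ b → ι a ≤ ι b
  ι-mono {a} {b} a≤b = toℚᵘ-cancel-≤ (ℚᵘP.≤-respʳ-≃ (ℚᵘP.≃-sym (ι≃ b))
    (ℚᵘP.≤-respˡ-≃ (ℚᵘP.≃-sym (ι≃ a))
    (*≤* (ℤP.*-monoʳ-≤-nonNeg (ℤ.+ 1) (ℤ.+≤+ a≤b)))))

  ι*inv : ∀ m → ι (suc m) * inv m ≡ 1ℚ
  ι*inv m = toℚᵘ-injective (begin
    toℚᵘ (ι (suc m) * inv m)             ≈⟨ toℚᵘ-homo-* (ι (suc m)) (inv m) ⟩
    toℚᵘ (ι (suc m)) ℚᵘ.* toℚᵘ (inv m)   ≈⟨ ℚᵘP.*-cong (ι≃ (suc m)) (inv≃ m) ⟩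
    ιᵘ (suc m) ℚᵘ.* mkℚᵘ (ℤ.+ 1) m         ≈⟨ ℚᵘP.*-inverseʳ (ιᵘ (suc m)) ⟩
    toℚᵘ 1ℚ                              ∎)
    where open ≃-Reasoning

  0≤ι : ∀ m → 0ℚ ≤ ι m
  0≤ι m = ι-mono {0} {m} z≤n

  0≤inv : ∀ m → 0ℚ ≤ inv m
  0≤inv m = toℚᵘ-cancel-≤ (ℚᵘP.≤-respʳ-≃ (ℚᵘP.≃-sym (inv≃ m)) (*≤* (ℤ.+≤+ z≤n)))

  0≤* : ∀ {p q} → 0ℚ ≤ p → 0ℚ ≤ q → 0ℚ ≤ p * q
  0≤* {p} {q} 0≤p 0≤q = ≤-trans (≤-reflexive (sym (*-zeroˡ q))) (*-monoʳ-≤-nonNeg q {{ℚ.nonNegative 0≤q}} 0≤p)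

  p≤p+q : ∀ p {q} → 0ℚ ≤ q → p ≤ p + q
  p≤p+q p 0≤q = ≤-trans (≤-reflexive (sym (+-identityʳ p))) (+-monoʳ-≤ p 0≤q)

  ι-suc-* : ∀ m U → ι (suc m) * U ≡ U + ι m * U
  ι-suc-* m U = trans (cong (_* U) (ι-+ 1 m)) (trans (*-distribʳ-+ U 1ℚ (ι m)) (cong (_+ ι m * U) (*-identityˡ U)))

  ∣-∣-bound : ∀ {p q c} → p ≤ q → q ≤ p + c → ∣ q - p ∣ ≤ c
  ∣-∣-bound {p} {q} {c} p≤q q≤p+c = begin
    ∣ q - p ∣      ≡⟨ 0≤p⇒∣p∣≡p 0≤q-p ⟩
    q - p          ≤⟨ +-monoˡ-≤ (ℚ.- p) q≤p+c ⟩
    (p + c) - p    ≡⟨ cong (_- p) (+-comm p c) ⟩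
    (c + p) - p    ≡⟨ +-assoc c p (ℚ.- p) ⟩
    c + (p - p)    ≡⟨ cong (c +_) (+-inverseʳ p) ⟩
    c + 0ℚ         ≡⟨ +-identityʳ c ⟩
    c              ∎
    where
    open ≤-Reasoning
    0≤q-p : 0ℚ ≤ q - p
    0≤q-p = ≤-trans (≤-reflexive (sym (+-inverseʳ p))) (+-monoˡ-≤ (ℚ.- p) p≤q)

  module _ {A : Set} (g : A → ℚ) where

    sum-≤ : ∀ U xs → All (λ x → g x ≤ U) xs → sumℚ (map g xs) ≤ ι (length xs) * U
    sum-≤ U []       []       = ≤-reflexive (sym (*-zeroˡ U))
    sum-≤ U (x ∷ xs) (h ∷ hs) = ≤-trans (+-mono-≤ h (sum-≤ U xs hs)) (≤-reflexive (sym (ι-suc-* (length xs) U)))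

    sum-≥ : ∀ U xs → All (λ x → U ≤ g x) xs → ι (length xs) * U ≤ sumℚ (map g xs)
    sum-≥ U []       []       = ≤-reflexive (*-zeroˡ U)
    sum-≥ U (x ∷ xs) (h ∷ hs) = ≤-trans (≤-reflexive (ι-suc-* (length xs) U)) (+-mono-≤ h (sum-≥ U xs hs))

    sum-split : {B : Pred A 0ℓ} (B? : Decidable B) (U V : ℚ) → 0ℚ ≤ U → ∀ xs →
      All (λ x → (B x → g x ≤ V) × (¬ B x → g x ≤ U)) xs →
      sumℚ (map g xs) ≤ ι (length xs) * U + ι (length (filter B? xs)) * V
    sum-split B? U V 0≤U [] [] = ≤-reflexive (sym (trans (cong₂ _+_ (*-zeroˡ U) (*-zeroˡ V)) (+-identityˡ 0ℚ)))
    sum-split B? U V 0≤U (x ∷ xs) ((onB , offB) ∷ hs) with B? x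
    ... | yes b = begin
      g x + S                      ≤⟨ +-monoˡ-≤ S (≤-trans (onB b) V≤U+V) ⟩
      (U + V) + S                  ≤⟨ +-monoʳ-≤ (U + V) IH ⟩
      (U + V) + (LU + LV)          ≡⟨ interchange U V LU LV ⟩
      (U + LU) + (V + LV)          ≡⟨ sym (cong₂ _+_ (ι-suc-* (length xs) U) (ι-suc-* (length (filter B? xs)) V)) ⟩
      ι (suc (length xs)) * U + ι (suc (length (filter B? xs))) * V ∎
      where
      open ≤-Reasoning
      S = sumℚ (map g xs)
      LU = ι (length xs) * U
      LV = ι (length (filter B? xs)) * V
      IH = sum-split B? U V 0≤U xs hs
      V≤U+V : V ≤ U + V
      V≤U+V = ≤-trans (≤-reflexive (sym (+-identityˡ V))) (+-monoˡ-≤ V 0≤U)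
      interchange : ∀ a b c d → (a + b) + (c + d) ≡ (a + c) + (b + d)
      interchange a b c d = trans (+-assoc a b (c + d)) (trans (cong (a +_) (trans (sym (+-assoc b c d))
        (trans (cong (_+ d) (+-comm b c)) (+-assoc c b d)))) (sym (+-assoc a c (b + d))))
    ... | no ¬b = ≤-trans (+-mono-≤ (offB ¬b) (sum-split B? U V 0≤U xs hs))
      (≤-reflexive (trans (sym (+-assoc U _ _)) (cong (_+ ι (length (filter B? xs)) * V) (sym (ι-suc-* (length xs) U)))))

  private
    cancel : ∀ m U → (ι (suc m) * U) * inv m ≡ U
    cancel m U = begin
      (ι (suc m) * U) * inv m   ≡⟨ *-assoc (ι (suc m)) U (inv m) ⟩
      ι (suc m) * (U * inv m)   ≡⟨ cong (ι (suc m) *_) (*-comm U (inv m)) ⟩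
      ι (suc m) * (inv m * U)   ≡⟨ sym (*-assoc (ι (suc m)) (inv m) U) ⟩
      (ι (suc m) * inv m) * U   ≡⟨ cong (_* U) (ι*inv m) ⟩
      1ℚ * U                    ≡⟨ *-identityˡ U ⟩
      U                         ∎
      where open ≡-Reasoning

  avg-≤ : ∀ m s U → s ≤ ι (suc m) * U → s * inv m ≤ U
  avg-≤ m s U h = ≤-trans (*-monoʳ-≤-nonNeg (inv m) {{ℚ.nonNegative (0≤inv m)}} h) (≤-reflexive (cancel m U))

  avg-≥ : ∀ m s U → ι (suc m) * U ≤ s → U ≤ s * inv m
  avg-≥ m s U h = ≤-trans (≤-reflexive (sym (cancel m U))) (*-monoʳ-≤-nonNeg (inv m) {{ℚ.nonNegative (0≤inv m)}} h)

module VectorCount where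

  open import Data.Nat using (ℕ; zero; suc; _≤_; _+_; _*_; _^_)
  open import Data.Nat.Properties using (≤-refl; ≤-trans; ≤-reflexive; *-mono-≤; *-assoc)
  open import Data.Nat.Tactic.RingSolver using (solve-∀)
  open import Data.Fin using (Fin) renaming (zero to fzero; suc to fsuc)
  open import Data.Fin.Properties using (all?; suc-injective)
  open import Data.Vec using ([]; _∷_; lookup)
  open import Data.List using (List; []; _∷_; length; map; concat; allFin)
  open import Data.List.Properties using (length-++; length-map; length-tabulate)
  open import Data.List.Relation.Unary.Any using (here; there)
  open import Data.List.Membership.Propositional using (_∈_)
  open import Data.List.Membership.Propositional.Properties using (∈-allFin; ∈-++⁺ˡ; ∈-++⁺ʳ; ∈-map⁺)
  open import Relation.Nullary using (Dec; yes; no; does; contradiction)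
  open import Relation.Binary.PropositionalEquality using (_≡_; _≢_; refl; sym; trans; cong; cong₂)
  open import Data.Bool using (if_then_else_)
  open import Defs using (Cube; allVecs)
  open ListCount

  ∏ : ∀ m → (Fin m → ℕ) → ℕ
  ∏ zero    f = 1
  ∏ (suc m) f = f fzero * ∏ m (λ c → f (fsuc c))

  private
    interchange : ∀ k g q p → (k * g) * (q * p) ≡ (k * q) * (g * p)
    interchange = solve-∀

  ∏-mono : ∀ m k (b g : Fin m → ℕ) → (∀ c → b c ≤ k * g c) → ∏ m b ≤ k ^ m * ∏ m g
  ∏-mono zero    k b g h = ≤-refl
  ∏-mono (suc m) k b g h =
    ≤-trans (*-mono-≤ (h fzero) (∏-mono m k (λ c → b (fsuc c)) (λ c → g (fsuc c)) (λ c → h (fsuc c))))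
    (≤-reflexive (interchange k (g fzero) (k ^ m) _))

  ∏-compare : ∀ m k a (b g : Fin m → ℕ) (c : Fin m) → (∀ c' → c' ≢ c → b c' ≤ k * g c') →
    a * b c ≤ k * g c → a * ∏ m b ≤ k ^ m * ∏ m g
  ∏-compare (suc m) k a b g fzero h hc = ≤-trans (≤-reflexive (sym (*-assoc a (b fzero) _)))
    (≤-trans (*-mono-≤ hc (∏-mono m k (λ c → b (fsuc c)) (λ c → g (fsuc c)) (λ c → h (fsuc c) (λ ()))))
    (≤-reflexive (interchange k (g fzero) (k ^ m) _)))
  ∏-compare (suc m) k a b g (fsuc c) h hc = ≤-trans (≤-reflexive (swap a (b fzero) _))
    (≤-trans (*-mono-≤ (h fzero (λ ())) (∏-compare m k a (λ c → b (fsuc c)) (λ c → g (fsuc c)) c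
               (λ c' c'≢c → h (fsuc c') (λ eq → c'≢c (suc-injective eq))) hc))
    (≤-reflexive (interchange k (g fzero) (k ^ m) _)))
    where
    swap : ∀ a b p → a * (b * p) ≡ b * (a * p)
    swap = solve-∀

  module _ {N : ℕ} where

    allVecs-complete : ∀ {m} (x : Cube N m) → x ∈ allVecs N m
    allVecs-complete []            = here refl
    allVecs-complete {suc m} (k ∷ x) = go (allFin (suc N)) (∈-allFin k)
      where
      go : ∀ ks → k ∈ ks → (k ∷ x) ∈ concat (map (λ k → map (k ∷_) (allVecs N m)) ks)
      go (k' ∷ ks) (here refl) = ∈-++⁺ˡ (∈-map⁺ (k ∷_) (allVecs-complete x))
      go (k' ∷ ks) (there k∈)  = ∈-++⁺ʳ (map (k' ∷_) (allVecs N m)) (go ks k∈)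

    length-allVecs : ∀ m → length (allVecs N m) ≡ suc N ^ m
    length-allVecs zero    = refl
    length-allVecs (suc m) = trans (go (allFin (suc N)))
      (cong₂ _*_ (length-tabulate {n = suc N} (λ x → x)) (length-allVecs m))
      where
      go : ∀ ks → length (concat (map (λ k → map (k ∷_) (allVecs N m)) ks)) ≡ length ks * length (allVecs N m)
      go []       = refl
      go (k ∷ ks) = trans (length-++ (map (k ∷_) (allVecs N m)))
        (cong₂ _+_ (length-map (k ∷_) (allVecs N m)) (go ks))

    Coordinatewise : ∀ {m} → (Fin m → Fin (suc N) → Set) → Cube N m → Set
    Coordinatewise T x = ∀ c → T c (lookup x c)

    coordinatewise? : ∀ {m} {T : Fin m → Fin (suc N) → Set} → (∀ c y → Dec (T c y)) →
      ∀ x → Dec (Coordinatewise T x)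
    coordinatewise? T? x = all? (λ c → T? c (lookup x c))

    count-coordinatewise : ∀ m {T : Fin m → Fin (suc N) → Set} (T? : ∀ c y → Dec (T c y)) →
      count (coordinatewise? T?) (allVecs N m) ≡ ∏ m (λ c → count (T? c) (allFin (suc N)))
    count-coordinatewise zero T? with coordinatewise? T? []
    ... | yes _ = refl
    ... | no ¬h = contradiction (λ ()) ¬h
    count-coordinatewise (suc m) {T} T? =
      trans (split (allFin (suc N))) (cong (count (T? fzero) (allFin (suc N)) *_) (count-coordinatewise m T?′))
      where
      T?′ : ∀ c y → Dec (T (fsuc c) y)
      T?′ c = T? (fsuc c)
      V : List (Cube N m)
      V = allVecs N m
      slice : ∀ k → count (coordinatewise? T?) (map (k ∷_) V) ≡
                    (if does (T? fzero k) then count (coordinatewise? T?′) V else 0)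
      slice k = trans (count-map (coordinatewise? T?) (k ∷_) V) (by (T? fzero k))
        where
        by : (d : Dec (T fzero k)) → count (λ v → coordinatewise? T? (k ∷ v)) V ≡
                                      (if does d then count (coordinatewise? T?′) V else 0)
        by (yes t) = count-cong (λ v → coordinatewise? T? (k ∷ v)) (coordinatewise? T?′)
                       (λ all c → all (fsuc c)) (λ { all fzero → t ; all (fsuc c) → all c }) V
        by (no ¬t) = count-none (λ v → coordinatewise? T? (k ∷ v)) (λ v all → ¬t (all fzero)) V
      split : ∀ ks → count (coordinatewise? T?) (concat (map (λ k → map (k ∷_) V) ks)) ≡
                     count (T? fzero) ks * count (coordinatewise? T?′) V
      split []       = refl
      split (k ∷ ks) with T? fzero k | slice k
      ... | yes _ | e = trans (count-++ (coordinatewise? T?) (map (k ∷_) V) _) (cong₂ _+_ e (split ks))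
      ... | no  _ | e = trans (count-++ (coordinatewise? T?) (map (k ∷_) V) _) (cong₂ _+_ e (split ks))

module CubeFacts where

  open import Data.Nat using (ℕ; suc; _≤_; _+_; _^_; z≤n; s≤s)
  open import Data.Nat.Properties using (≤-refl; ≤-trans; ≤-reflexive; +-mono-≤; +-identityʳ; module ≤-Reasoning)
  open import Data.Fin using (Fin; fromℕ) renaming (zero to fzero; suc to fsuc)
  open import Data.Fin.Properties using (_≟_)
  open import Data.Vec using ([]; _∷_; head; tail)
  open import Data.List using (List; []; _∷_; length; map; filter)
  open import Data.List.Properties using (length-map)
  open import Data.List.Relation.Unary.All using (_∷_)
  open import Data.List.Relation.Unary.All.Properties using (all-filter)
  open import Data.List.Relation.Unary.AllPairs using (AllPairs; []; _∷_)
  import Data.List.Relation.Unary.AllPairs.Properties as AllPairs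
  open import Data.Product using (_,_)
  open import Data.Sum using (_⊎_; inj₁; inj₂)
  open import Relation.Nullary using (¬_; Dec; contradiction)
  open import Relation.Nullary.Decidable using (_⊎-dec_; ¬?)
  open import Relation.Binary.PropositionalEquality using (_≡_; _≢_; refl; sym; trans; cong)
  open import Function using (_on_)
  open import Defs using (Cube; Extreme; NonOverlapping)
  open ListCount

  module _ {N : ℕ} where

    Ext : Fin (suc N) → Set
    Ext a = a ≡ fzero ⊎ a ≡ fromℕ N

    ext? : ∀ a → Dec (Ext a)
    ext? a = (a ≟ fzero) ⊎-dec (a ≟ fromℕ N)

    Extreme-sym : ∀ {a b : Fin (suc N)} → Extreme a b → Extreme b a
    Extreme-sym (inj₁ (a≡0 , b≡1)) = inj₂ (b≡1 , a≡0)
    Extreme-sym (inj₂ (a≡1 , b≡0)) = inj₁ (b≡0 , a≡1)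

    Extreme⇒Extˡ : ∀ {a b : Fin (suc N)} → Extreme a b → Ext a
    Extreme⇒Extˡ (inj₁ (a≡0 , _)) = inj₁ a≡0
    Extreme⇒Extˡ (inj₂ (a≡1 , _)) = inj₂ a≡1

    Extreme⇒Extʳ : ∀ {a b : Fin (suc N)} → Extreme a b → Ext b
    Extreme⇒Extʳ e = Extreme⇒Extˡ (Extreme-sym e)

  module NonDegenerate {N : ℕ} (0≢1 : fzero ≢ fromℕ N) where

    Extreme-irrefl : ∀ {a : Fin (suc N)} → ¬ Extreme a a
    Extreme-irrefl (inj₁ (a≡0 , a≡1)) = 0≢1 (trans (sym a≡0) a≡1)
    Extreme-irrefl (inj₂ (a≡1 , a≡0)) = 0≢1 (trans (sym a≡0) a≡1)

    Extreme-unique : ∀ {a b c : Fin (suc N)} → Extreme a b → Extreme b c → a ≡ c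
    Extreme-unique (inj₁ (_ , b≡1))   (inj₁ (b≡0 , _))   = contradiction (trans (sym b≡0) b≡1) 0≢1
    Extreme-unique (inj₁ (a≡0 , _))   (inj₂ (_ , c≡0))   = trans a≡0 (sym c≡0)
    Extreme-unique (inj₂ (a≡1 , _))   (inj₁ (_ , c≡1))   = trans a≡1 (sym c≡1)
    Extreme-unique (inj₂ (_ , b≡0))   (inj₂ (b≡1 , _))   = contradiction (trans (sym b≡0) b≡1) 0≢1

    -- The cubes whose first coordinate avoids a fixed value v ∈ {0,1} cannot be
    -- separated in that coordinate, so their tails are pairwise non-overlapping; every
    -- cube avoids 0 or avoids 1.
    packing-bound : ∀ {m} (S : List (Cube N m)) → AllPairs NonOverlapping S → length S ≤ 2 ^ m
    packing-bound {m = 0} []          _                       = z≤n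
    packing-bound {m = 0} (x ∷ [])    _                       = s≤s z≤n
    packing-bound {m = 0} (x ∷ y ∷ S) (((() , _) ∷ _) ∷ _)
    packing-bound {m = suc m} S pairwise = begin
      length S                                     ≡⟨ sym (count-complement (λ x → head x ≟ fromℕ N) S) ⟩
      count (λ x → head x ≟ fromℕ N) S + count (avoid? (fromℕ N)) S
                                                   ≤⟨ +-mono-≤ (count-mono (λ x → head x ≟ fromℕ N) (avoid? fzero) 1≢0 S) ≤-refl ⟩
      count (avoid? fzero) S + count (avoid? (fromℕ N)) S
                                                   ≤⟨ +-mono-≤ (class-bound fzero 0-involved) (class-bound (fromℕ N) 1-involved) ⟩
      2 ^ m + 2 ^ m                                ≡⟨ cong (2 ^ m +_) (sym (+-identityʳ (2 ^ m))) ⟩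
      2 ^ suc m                                    ∎
      where
      open ≤-Reasoning
      Avoid : Fin (suc N) → Cube N (suc m) → Set
      Avoid v x = ¬ head x ≡ v
      avoid? : ∀ v x → Dec (Avoid v x)
      avoid? v x = ¬? (head x ≟ v)
      1≢0 : ∀ {a : Fin (suc N)} → a ≡ fromℕ N → ¬ a ≡ fzero
      1≢0 a≡1 a≡0 = 0≢1 (trans (sym a≡0) a≡1)
      0-involved : ∀ {a b : Fin (suc N)} → Extreme a b → a ≡ fzero ⊎ b ≡ fzero
      0-involved (inj₁ (a≡0 , _)) = inj₁ a≡0
      0-involved (inj₂ (_ , b≡0)) = inj₂ b≡0
      1-involved : ∀ {a b : Fin (suc N)} → Extreme a b → a ≡ fromℕ N ⊎ b ≡ fromℕ N
      1-involved (inj₁ (_ , b≡1)) = inj₂ b≡1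
      1-involved (inj₂ (a≡1 , _)) = inj₁ a≡1
      class-bound : ∀ v → (∀ {a b} → Extreme a b → a ≡ v ⊎ b ≡ v) →
        count (avoid? v) S ≤ 2 ^ m
      class-bound v involved = ≤-trans (≤-reflexive (sym (length-map tail (filter (avoid? v) S))))
        (packing-bound (map tail (filter (avoid? v) S))
          (AllPairs.map⁺ (allPairs-restrict {R′ = NonOverlapping on tail} (λ {x} {y} → separated {x} {y})
            (all-filter (avoid? v) S) (AllPairs.filter⁺ (avoid? v) pairwise))))
        where
        separated : ∀ {x y} → Avoid v x → Avoid v y → NonOverlapping x y → (NonOverlapping on tail) x y
        separated {_ ∷ _} {_ ∷ _} x≢v y≢v (fzero  , e) with involved e
        ... | inj₁ x≡v = contradiction x≡v x≢v
        ... | inj₂ y≡v = contradiction y≡v y≢v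
        separated {_ ∷ _} {_ ∷ _} x≢v y≢v (fsuc i , e) = i , e

module Process where

  open import Data.Nat as ℕ using (ℕ; zero; suc; _<_)
  open import Data.Nat.Properties using (≤-pred; <-≤-trans; n≮0; n≤0⇒n≡0)
  open import Data.Fin using (fromℕ) renaming (zero to fzero)
  open import Data.List using (List; []; _∷_; length; map)
  open import Data.List.Relation.Unary.All as All using (All; _∷_)
  open import Data.List.Relation.Unary.All.Properties using (all-filter)
  open import Data.Rational as ℚ using (ℚ; _≤_)
  open import Data.Product using (_×_; _,_)
  open import Relation.Binary.PropositionalEquality using (_≡_; _≢_; refl; cong)
  open import Defs
  open ListCount
  open RationalArith
  open VectorCount using (allVecs-complete)
  open CubeFacts using (module NonDegenerate)

  module _ {N n : ℕ} (0≢1 : fzero ≢ fromℕ N) where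

    open NonDegenerate 0≢1 using (Extreme-irrefl)

    -- Every available cube is addable, and adding it makes strictly fewer cubes
    -- available (the cube itself, which overlaps itself, is no longer available).
    available-addable : ∀ (S : Packing N n) → All (Addable S) (available S)
    available-addable S = all-filter (addable? S) (allVecs N n)

    available-shrinks : ∀ (S : Packing N n) {w} → Addable S w →
      length (available (w ∷ S)) < length (available S)
    available-shrinks S {w} addable = count-strict (addable? (w ∷ S)) (addable? S) All.tail
      (allVecs-complete w) addable (λ { ((_ , e) ∷ _) → Extreme-irrefl e })

    available-empty⇒maximal : ∀ (S : Packing N n) → length (available S) ≡ 0 → Maximal S
    available-empty⇒maximal S none z addable with count-pos (addable? S) (allVecs-complete z) addable
    ... | pos rewrite none = n≮0 pos

    step-≤ : ∀ f (S : Packing N n) U → (available S ≡ [] → lengthℚ S ≤ U) →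
      sumℚ (map (λ w → expectedFuel f (w ∷ S)) (available S)) ≤ ι (length (available S)) ℚ.* U →
      expectedFuel (suc f) S ≤ U
    step-≤ f S U final average with available S
    ... | []     = final refl
    ... | w ∷ ws = avg-≤ (length ws) _ U average

    step-≥ : ∀ f (S : Packing N n) U → (available S ≡ [] → U ≤ lengthℚ S) →
      ι (length (available S)) ℚ.* U ≤ sumℚ (map (λ w → expectedFuel f (w ∷ S)) (available S)) →
      U ≤ expectedFuel (suc f) S
    step-≥ f S U final average with available S
    ... | []     = final refl
    ... | w ∷ ws = avg-≥ (length ws) _ U average

    module _ (Good : Packing N n → Set) (preserved : ∀ {S w} → Good S → Addable S w → Good (w ∷ S)) where

      completion-good : ∀ {S Q} → Completion S Q → Good S → Good Q × Maximal Q
      completion-good (done maximal)      good = good , maximal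
      completion-good (step w addable Sw) good = completion-good Sw (preserved good addable)

      expected-≤ : ∀ U → (∀ {S} → Good S → lengthℚ S ≤ U) → ∀ f S → Good S → expectedFuel f S ≤ U
      expected-≤ U bound zero    S good = bound good
      expected-≤ U bound (suc f) S good = step-≤ f S U (λ _ → bound good)
        (sum-≤ _ U (available S) (All.map (λ addable → expected-≤ U bound f _ (preserved good addable)) (available-addable S)))

      expected-≥ : ∀ U → (∀ {S} → Good S → Maximal S → U ≤ lengthℚ S) →
        ∀ f S → Good S → length (available S) ℕ.≤ f → U ≤ expectedFuel f S
      expected-≥ U bound zero    S good enough = bound good (available-empty⇒maximal S (n≤0⇒n≡0 enough))
      expected-≥ U bound (suc f) S good enough = step-≥ f S U
        (λ none → bound good (available-empty⇒maximal S (cong length none)))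
        (sum-≥ _ U (available S) (All.map (λ {w} addable → expected-≥ U bound f _ (preserved good addable)
          (≤-pred (<-≤-trans (available-shrinks S addable) enough))) (available-addable S)))

module FirstCube where

  open import Data.Nat using (ℕ; zero; suc; _≤_; _<_; _+_; _*_; _^_; z≤n)
  open import Data.Nat.Properties using (≤-refl; ≤-trans; ≤-reflexive; ≤-pred; ≤-antisym; <-≤-trans; n≮0; m≤m+n; m≤m*n;
    +-suc; +-comm; +-identityʳ; +-mono-≤; +-monoˡ-≤; +-cancelʳ-≤; *-monoʳ-≤; *-zeroʳ; module ≤-Reasoning)
  open import Data.Nat.Tactic.RingSolver using (solve-∀)
  open import Data.Nat.ListAction using (sum)
  open import Data.Fin using (Fin; fromℕ) renaming (zero to fzero; suc to fsuc)
  open import Data.Fin.Properties using (_≟_; any?)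
  open import Data.Vec using (lookup; tabulate; _[_]≔_)
  open import Data.Vec.Properties using (lookup∘update; lookup∘update′; lookup∘tabulate)
  open import Data.List using (List; []; _∷_; length; map; _++_; allFin)
  open import Data.List.Properties using (length-++; length-tabulate)
  open import Data.List.Relation.Unary.All as All using (All; []; _∷_)
  open import Data.List.Relation.Unary.All.Properties using (all-filter; ++⁻ʳ; ¬All⇒Any¬)
  import Data.List.Relation.Unary.Any.Properties as Any
  open import Data.List.Relation.Unary.Any as Any using (Any; here; there)
  open import Data.List.Relation.Unary.AllPairs using (AllPairs; []; _∷_)
  import Data.List.Relation.Unary.Unique.Propositional.Properties as Unique
  open import Data.List.Membership.Propositional using (_∈_; _∉_; find)
  open import Data.List.Membership.Propositional.Properties using (∈-allFin; ∈-filter⁺)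
  import Data.List.Membership.DecPropositional as DecMembership
  open import Data.Product using (Σ; ∃-syntax; _×_; _,_; proj₁; proj₂)
  open import Data.Sum using (_⊎_; inj₁; inj₂; [_,_]′)
  open import Relation.Nullary using (¬_; Dec; yes; no; does; contradiction)
  open import Data.Bool using (if_then_else_)
  open import Function using (_∘_)
  open import Relation.Nullary.Decidable using (¬?; _×-dec_; _→-dec_)
  open import Relation.Binary.PropositionalEquality using (_≡_; _≢_; refl; sym; trans; cong; cong₂; subst; subst₂; module ≡-Reasoning)
  open import Defs
  open ListCount
  open CubeFacts
  open VectorCount
  open Process
  open RationalArith
  import Data.Rational as ℚ
  import Data.Rational.Properties as ℚ
  open import Data.Rational using (ℚ; 0ℚ; 1ℚ)

  -- The constant in the O(1/(N + 1)) error term of (ii): 2^n n² 6^n.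
  K : ℕ → ℕ
  K n = 2 ^ n * (n * (n * 6 ^ n))

  -- The process started from a single cube z, on the grid {0, 1/N, ..., 1}
  -- with N = k + 2 ≥ 2.
  module _ {k n : ℕ} (z : Cube (suc (suc k)) n) where

    N : ℕ
    N = suc (suc k)

    0≢1 : fzero ≢ fromℕ N
    0≢1 ()

    open NonDegenerate 0≢1
    open DecMembership (_≟_ {n}) using (_∈?_)

    I : List (Fin n)
    I = Iset z

    ∈I : ∀ {i} → Ext (lookup z i) → i ∈ I
    ∈I {i} = ∈-filter⁺ (λ i → ext? (lookup z i)) (∈-allFin i)

    I-ext : All (λ i → Ext (lookup z i)) I
    I-ext = all-filter (λ i → ext? (lookup z i)) (allFin n)

    I-unique : AllPairs (λ a b → ¬ a ≡ b) I
    I-unique = Unique.filter⁺ (λ i → ext? (lookup z i)) (Unique.allFin⁺ n)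

    withZ : List (Cube N n) → Packing N n
    withZ ws = ws ++ z ∷ []

    length-withZ : ∀ ws → length (withZ ws) ≡ length ws + 1
    length-withZ ws = length-++ ws

    addable⇒separated : ∀ ws {x} → Addable (withZ ws) x → NonOverlapping x z
    addable⇒separated ws addable with ++⁻ʳ ws addable
    ... | separated ∷ [] = separated

    Reachable : Packing N n → Set
    Reachable S = Σ (List (Cube N n)) λ ws → S ≡ withZ ws × All (λ w → NonOverlapping w z) ws

    reachable-step : ∀ {S w} → Reachable S → Addable S w → Reachable (w ∷ S)
    reachable-step {w = w} (ws , refl , separated) addable = w ∷ ws , refl , addable⇒separated ws {w} addable ∷ separated

    opposite : Fin (suc N) → Fin (suc N)
    opposite a with a ≟ fzero
    ... | yes _ = fromℕ N
    ... | no  _ = fzero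

    opposite-extreme : ∀ {a} → Ext a → Extreme (opposite a) a
    opposite-extreme {a} ext with a ≟ fzero
    ... | yes a≡0 = inj₂ (refl , a≡0)
    ... | no  a≢0 with ext
    ...   | inj₁ a≡0 = contradiction a≡0 a≢0
    ...   | inj₂ a≡1 = inj₁ (refl , a≡1)

    flipAt : Cube N n → Fin n → Cube N n
    flipAt x i = x [ i ]≔ opposite (lookup z i)

    flipAt-separates : ∀ x {i} → Ext (lookup z i) → Extreme (lookup (flipAt x i) i) (lookup z i)
    flipAt-separates x {i} ext = subst (λ a → Extreme a (lookup z i)) (sym (lookup∘update i x _)) (opposite-extreme ext)

    flipAt-elsewhere : ∀ x {i c} → c ≢ i → lookup (flipAt x i) c ≡ lookup x c
    flipAt-elsewhere x c≢i = lookup∘update′ c≢i x _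

    -- In a maximal packing z, ws (each w ∈ ws separated from z),
    -- for every j ∈ I the cube flipAt z j is separated from z, so it overlaps
    -- some w ∈ ws; w can only be separated from z in coordinate j.  Hence the
    -- coordinates separating the cubes of ws from z cover I.

    separators : ∀ {ws} → All (λ w → NonOverlapping w z) ws → List (Fin n)
    separators []             = []
    separators ((i , _) ∷ sep) = i ∷ separators sep

    length-separators : ∀ {ws} (sep : All (λ w → NonOverlapping w z) ws) → length (separators sep) ≡ length ws
    length-separators []        = refl
    length-separators (_ ∷ sep) = cong suc (length-separators sep)

    overlaps-flip : ∀ {ws j} (sep : All (λ w → NonOverlapping w z) ws) →
      Any (λ w → ¬ NonOverlapping (flipAt z j) w) ws → j ∈ separators sep
    overlaps-flip {j = j} ((i , e) ∷ sep) (here hit) with i ≟ j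
    ... | yes refl = here refl
    ... | no  i≢j  = contradiction (i , subst (λ a → Extreme a _) (sym (flipAt-elsewhere z i≢j)) (Extreme-sym e)) hit
    overlaps-flip (_ ∷ sep) (there hit) = there (overlaps-flip sep hit)

    maximal-size : ∀ ws → Maximal (withZ ws) → All (λ w → NonOverlapping w z) ws → length I ≤ length ws
    maximal-size ws maximal sep = ≤-trans (unique-⊆-length I-unique covered) (≤-reflexive (length-separators sep))
      where
      covered : ∀ {j} → j ∈ I → j ∈ separators sep
      covered {j} j∈I with Any.++⁻ ws (¬All⇒Any¬ (nonOverlapping? (flipAt z j)) (withZ ws) (maximal (flipAt z j)))
      ... | inj₁ hit        = overlaps-flip sep hit
      ... | inj₂ (here hit) = contradiction (j , flipAt-separates z (All.lookup I-ext j∈I)) hit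

    -- After z and ws have been placed there is a
    -- set P ⊆ I of "used" coordinates such that the cubes that can still be
    -- added are exactly those separated from z and agreeing with z on P.
    Agree : List (Fin n) → Cube N n → Set
    Agree P x = ∀ c → c ∈ P → lookup x c ≡ lookup z c

    record Invariant (P : List (Fin n)) (ws : List (Cube N n)) : Set where
      field
        addable⇒agree : ∀ x → Addable (withZ ws) x → Agree P x
        agree⇒addable : ∀ x → Agree P x → NonOverlapping x z → Addable (withZ ws) x
    open Invariant public

    invariant-start : Invariant [] []
    invariant-start = record { addable⇒agree = λ _ _ _ () ; agree⇒addable = λ _ _ separated → separated ∷ [] }

    remaining : List (Fin n) → ℕ
    remaining P = count (λ c → ¬? (c ∈? P)) I

    separated-fresh : ∀ P x {i} → Agree P x → Extreme (lookup x i) (lookup z i) → i ∉ P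
    separated-fresh P x agree e i∈P = Extreme-irrefl (subst (λ a → Extreme a _) (agree _ i∈P) e)

    -- Every addable cube uses up a fresh coordinate of I, so remaining P > 0.
    remaining-pos : ∀ {P ws w} → Invariant P ws → Addable (withZ ws) w → 0 < remaining P
    remaining-pos {P} {ws} {w} inv addable with addable⇒separated ws {w} addable
    ... | i , e = count-pos (λ c → ¬? (c ∈? P)) (∈I (Extreme⇒Extʳ e)) (separated-fresh P w (addable⇒agree inv w addable) e)

    SingleExtreme : List (Fin n) → Cube N n → Fin n → Set
    SingleExtreme P x i = ∀ c → c ∉ P → Ext (lookup x c) → c ≡ i

    module Step {P ws w i} (inv : Invariant P ws) (addable : Addable (withZ ws) w)
                (e : Extreme (lookup w i) (lookup z i)) (single : SingleExtreme P w i) where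

      invariant-step : Invariant (i ∷ P) (w ∷ ws)
      invariant-step = record { addable⇒agree = sound ; agree⇒addable = complete }
        where
        sound : ∀ x → Addable (withZ (w ∷ ws)) x → Agree (i ∷ P) x
        sound x ((c , e′) ∷ addable′) c′ (there c′∈P) = addable⇒agree inv x addable′ c′ c′∈P
        sound x ((c , e′) ∷ addable′) _  (here refl) with c ∈? P
        ... | yes c∈P = contradiction (subst₂ Extreme (addable⇒agree inv x addable′ c c∈P) (addable⇒agree inv w addable c c∈P) e′)
                          Extreme-irrefl
        ... | no  c∉P = Extreme-unique (subst (λ c → Extreme (lookup x c) (lookup w c)) (single c c∉P (Extreme⇒Extʳ e′)) e′) e
        complete : ∀ x → Agree (i ∷ P) x → NonOverlapping x z → Addable (withZ (w ∷ ws)) x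
        complete x agree separated =
          (i , subst (λ a → Extreme a (lookup w i)) (sym (agree i (here refl))) (Extreme-sym e))
          ∷ agree⇒addable inv x (λ c c∈P → agree c (there c∈P)) separated

      remaining-step : remaining (i ∷ P) < remaining P
      remaining-step = count-strict (λ c → ¬? (c ∈? (i ∷ P))) (λ c → ¬? (c ∈? P))
        (λ c∉iP c∈P → c∉iP (there c∈P)) (∈I (Extreme⇒Extʳ e))
        (separated-fresh P w (addable⇒agree inv w addable) e) (λ i∉iP → i∉iP (here refl))

    -- While some coordinate i ∈ I is
    -- unused, add the cube that agrees with z on P, is opposite to z in
    -- coordinate i and equals 1/N elsewhere; each step uses up one coordinate.

    -- The interior value 1/N (interior because N ≥ 2).
    mid : Fin (suc N)
    mid = fsuc fzero

    mid-interior : ¬ Ext mid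
    mid-interior (inj₁ ())
    mid-interior (inj₂ ())

    background : List (Fin n) → Cube N n
    background P = tabulate (λ c → if does (c ∈? P) then lookup z c else mid)

    background-∈ : ∀ P {c} → c ∈ P → lookup (background P) c ≡ lookup z c
    background-∈ P {c} c∈P rewrite lookup∘tabulate (λ c → if does (c ∈? P) then lookup z c else mid) c with c ∈? P
    ... | yes _   = refl
    ... | no  c∉P = contradiction c∈P c∉P

    background-∉ : ∀ P {c} → c ∉ P → lookup (background P) c ≡ mid
    background-∉ P {c} c∉P rewrite lookup∘tabulate (λ c → if does (c ∈? P) then lookup z c else mid) c with c ∈? P
    ... | yes c∈P = contradiction c∈P c∉P
    ... | no  _   = refl

    greedyCube : List (Fin n) → Fin n → Cube N n
    greedyCube P i = flipAt (background P) i

    module Greedy {P ws} (inv : Invariant P ws) {i} (i∈I : i ∈ I) (i∉P : i ∉ P) where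

      separates : Extreme (lookup (greedyCube P i) i) (lookup z i)
      separates = flipAt-separates (background P) (All.lookup I-ext i∈I)

      addable : Addable (withZ ws) (greedyCube P i)
      addable = agree⇒addable inv (greedyCube P i) agree (i , separates)
        where
        agree : Agree P (greedyCube P i)
        agree c c∈P = trans (flipAt-elsewhere (background P) (λ { refl → i∉P c∈P })) (background-∈ P c∈P)

      single : SingleExtreme P (greedyCube P i) i
      single c c∉P ext with c ≟ i
      ... | yes c≡i = c≡i
      ... | no  c≢i = contradiction (subst Ext (trans (flipAt-elsewhere (background P) c≢i) (background-∉ P c∉P)) ext) mid-interior

      open Step {w = greedyCube P i} inv addable separates single public

    greedy : ∀ r P ws → Invariant P ws → remaining P ≤ r →
      ∃[ Q ] Completion (withZ ws) Q × length Q ≤ length ws + r + 1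
    greedy r P ws inv rem≤r with Any.any? (λ c → ¬? (c ∈? P)) I
    ... | no none = withZ ws , done maximal , ≤-trans (≤-reflexive (length-withZ ws)) (+-monoˡ-≤ 1 (m≤m+n (length ws) r))
      where
      maximal : Maximal (withZ ws)
      maximal x addable with addable⇒separated ws {x} addable
      ... | c , e = none (Any.map (λ { refl → separated-fresh P x (addable⇒agree inv x addable) e }) (∈I (Extreme⇒Extʳ e)))
    ... | yes fresh with find fresh
    ... | i , i∈I , i∉P = add-greedyCube r rem≤r
      where
      open Greedy inv i∈I i∉P
      add-greedyCube : ∀ r → remaining P ≤ r → ∃[ Q ] Completion (withZ ws) Q × length Q ≤ length ws + r + 1
      add-greedyCube zero     rem≤0 = contradiction (<-≤-trans remaining-step rem≤0) n≮0
      add-greedyCube (suc r′) rem≤r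
        with greedy r′ (i ∷ P) (greedyCube P i ∷ ws) invariant-step (≤-pred (<-≤-trans remaining-step rem≤r))
      ... | Q , completion , bound = Q , step _ addable completion , ≤-trans bound (≤-reflexive (cong (_+ 1) (sym (+-suc (length ws) r′))))

    -- An addable cube is
    -- "doubly extreme" if it has two extreme coordinates outside P; adding any
    -- other addable cube uses up exactly one coordinate of I.  We show that doubly
    -- extreme cubes form a fraction O(1/N) of the available ones, by comparing,
    -- coordinate by coordinate, with cubes that are interior outside P ∪ {a}.

    values : List (Fin (suc N))
    values = allFin (suc N)

    interior : ℕ
    interior = count (λ y → ¬? (ext? y)) values

    extreme-values : count ext? values ≤ 2
    extreme-values = ≤-trans (union-bound ext? (λ j y → y ≟ j) ends values (All.tabulate (λ _ → cover)))
      (sum-≤-length ends (λ j → count-unique _≟_ j values (Unique.allFin⁺ (suc N))))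
      where
      ends : List (Fin (suc N))
      ends = fzero ∷ fromℕ N ∷ []
      cover : ∀ {y} → Ext y → Any (y ≡_) ends
      cover (inj₁ y≡0) = here y≡0
      cover (inj₂ y≡1) = there (here y≡1)
      sum-≤-length : ∀ J {f : Fin (suc N) → ℕ} → (∀ j → f j ≤ 1) → sum (map f J) ≤ length J
      sum-≤-length []      f≤1 = z≤n
      sum-≤-length (j ∷ J) f≤1 = +-mono-≤ (f≤1 j) (sum-≤-length J f≤1)

    N+1≤interior+2 : suc N ≤ interior + 2
    N+1≤interior+2 = begin
      suc N                                   ≡⟨ sym (length-tabulate {n = suc N} (λ y → y)) ⟩
      length values                           ≡⟨ sym (count-complement ext? values) ⟩
      count ext? values + interior            ≤⟨ +-monoˡ-≤ interior extreme-values ⟩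
      2 + interior                            ≡⟨ +-comm 2 interior ⟩
      interior + 2                            ∎
      where open ≤-Reasoning

    -- Since N ≥ 2, there are at least (N + 1)/3 interior values.
    2[N+1]≤6·interior : suc N * 2 ≤ 6 * interior
    2[N+1]≤6·interior = begin
      suc N * 2                 ≤⟨ m≤m+n (suc N * 2) (4 * k) ⟩
      suc N * 2 + 4 * k         ≡⟨ identity k ⟩
      6 * suc k                 ≤⟨ *-monoʳ-≤ 6 k+1≤interior ⟩
      6 * interior              ∎
      where
      open ≤-Reasoning
      identity : ∀ k → (3 + k) * 2 + 4 * k ≡ 6 * suc k
      identity = solve-∀
      k+1≤interior : suc k ≤ interior
      k+1≤interior = +-cancelʳ-≤ 2 (suc k) interior (≤-trans (≤-reflexive (+-comm (suc k) 2)) N+1≤interior+2)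

    N+1≤6·interior : suc N ≤ 6 * interior
    N+1≤6·interior = ≤-trans (m≤m*n (suc N) 2) 2[N+1]≤6·interior

    module Spoilers {P ws} (inv : Invariant P ws) where

      Av : List (Cube N n)
      Av = available (withZ ws)

      DoublyExtreme : Cube N n → Set
      DoublyExtreme x = Σ (Fin n) λ c → Σ (Fin n) λ c′ →
        c ≢ c′ × c ∉ P × c′ ∉ P × Ext (lookup x c) × Ext (lookup x c′)

      doublyExtreme? : ∀ x → Dec (DoublyExtreme x)
      doublyExtreme? x = any? λ c → any? λ c′ → ¬? (c ≟ c′) ×-dec ¬? (c ∈? P) ×-dec ¬? (c′ ∈? P)
        ×-dec ext? (lookup x c) ×-dec ext? (lookup x c′)

      SpoilerValue : Fin n → Fin n → Fin n → Fin (suc N) → Set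
      SpoilerValue a c c′ y = (c′ ∈ P → y ≡ lookup z c′) × (c′ ≡ a → Extreme y (lookup z a)) × (c′ ≡ c → Ext y)

      spoilerValue? : ∀ a c c′ y → Dec (SpoilerValue a c c′ y)
      spoilerValue? a c c′ y = ((c′ ∈? P) →-dec (y ≟ lookup z c′)) ×-dec ((c′ ≟ a) →-dec extreme? y (lookup z a))
        ×-dec ((c′ ≟ c) →-dec ext? y)

      GoodValue : Fin n → Fin n → Fin (suc N) → Set
      GoodValue a c′ y = (c′ ∈ P → y ≡ lookup z c′) × (c′ ≡ a → Extreme y (lookup z a)) × (c′ ∉ P → c′ ≢ a → ¬ Ext y)

      goodValue? : ∀ a c′ y → Dec (GoodValue a c′ y)
      goodValue? a c′ y = ((c′ ∈? P) →-dec (y ≟ lookup z c′)) ×-dec ((c′ ≟ a) →-dec extreme? y (lookup z a))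
        ×-dec (¬? (c′ ∈? P) →-dec (¬? (c′ ≟ a) →-dec ¬? (ext? y)))

      good-addable : ∀ a x → Coordinatewise (GoodValue a) x → Addable (withZ ws) x
      good-addable a x good = agree⇒addable inv x (λ c c∈P → proj₁ (good c) c∈P) (a , proj₁ (proj₂ (good a)) refl)

      Distinct : Fin n → Fin n → Set
      Distinct a c = a ∉ P × c ∉ P × c ≢ a

      distinct? : ∀ a c → Dec (Distinct a c)
      distinct? a c = ¬? (a ∈? P) ×-dec ¬? (c ∈? P) ×-dec ¬? (c ≟ a)

      Spoiler : Fin n → Fin n → Cube N n → Set
      Spoiler a c x = Distinct a c × Coordinatewise (SpoilerValue a c) x

      spoiler? : ∀ a c x → Dec (Spoiler a c x)
      spoiler? a c x = distinct? a c ×-dec coordinatewise? (spoilerValue? a c) x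

      spoiler-cover : ∀ x → Addable (withZ ws) x → DoublyExtreme x → Σ (Fin n) λ a → Σ (Fin n) λ c → Spoiler a c x
      spoiler-cover x addable (c₁ , c₂ , c₁≢c₂ , c₁∉P , c₂∉P , ext₁ , ext₂) with addable⇒separated ws {x} addable
      ... | a , e = a , choose (c₁ ≟ a)
        where
        a∉P : a ∉ P
        a∉P = separated-fresh P x (addable⇒agree inv x addable) e
        values-of : ∀ c → Ext (lookup x c) → Coordinatewise (SpoilerValue a c) x
        values-of c ext c′ = addable⇒agree inv x addable c′ , (λ { refl → e }) , (λ { refl → ext })
        choose : Dec (c₁ ≡ a) → Σ (Fin n) λ c → Spoiler a c x
        choose (no  c₁≢a) = c₁ , (a∉P , c₁∉P , c₁≢a) , values-of c₁ ext₁
        choose (yes c₁≡a) = c₂ , (a∉P , c₂∉P , λ c₂≡a → c₁≢c₂ (trans c₁≡a (sym c₂≡a))) , values-of c₂ ext₂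

      spoiler-bound : ∀ a c → suc N * count (spoiler? a c) Av ≤ 6 ^ n * length Av
      spoiler-bound a c = by-cases (distinct? a c)
        where
        b g : Fin n → ℕ
        b c′ = count (spoilerValue? a c c′) values
        g c′ = count (goodValue? a c′) values

        b≤g : ∀ c′ → (c′ ∈ P ⊎ c′ ≡ a) → b c′ ≤ g c′
        b≤g c′ fixed = count-mono (spoilerValue? a c c′) (goodValue? a c′)
          (λ (agree , opposite , _) → agree , opposite , λ c′∉P c′≢a _ → [ c′∉P , c′≢a ]′ fixed) values

        interior≤g : ∀ c′ → c′ ∉ P → c′ ≢ a → interior ≤ g c′
        interior≤g c′ c′∉P c′≢a = count-mono (λ y → ¬? (ext? y)) (goodValue? a c′)
          (λ ¬ext → (λ c′∈P → contradiction c′∈P c′∉P) , (λ c′≡a → contradiction c′≡a c′≢a) , λ _ _ → ¬ext) values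

        -- In a free coordinate c′ ≠ a, at least a third of all N + 1 values is interior.
        factor : ∀ c′ → c′ ≢ c → b c′ ≤ 6 * g c′
        factor c′ _ = by-position (c′ ∈? P) (c′ ≟ a)
         where
         by-position : Dec (c′ ∈ P) → Dec (c′ ≡ a) → b c′ ≤ 6 * g c′
         by-position (yes c′∈P) _          = ≤-trans (b≤g c′ (inj₁ c′∈P)) (m≤m+n (g c′) _)
         by-position (no  _)    (yes c′≡a) = ≤-trans (b≤g c′ (inj₂ c′≡a)) (m≤m+n (g c′) _)
         by-position (no  c′∉P) (no c′≢a)  = begin
          b c′            ≤⟨ count-≤-length (spoilerValue? a c c′) values ⟩
          length values   ≡⟨ length-tabulate {n = suc N} (λ y → y) ⟩
          suc N           ≤⟨ N+1≤6·interior ⟩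
          6 * interior    ≤⟨ *-monoʳ-≤ 6 (interior≤g c′ c′∉P c′≢a) ⟩
          6 * g c′        ∎
          where open ≤-Reasoning

        -- In coordinate c only the two extreme values are admissible for a spoiler.
        factor-c : c ∉ P → c ≢ a → suc N * b c ≤ 6 * g c
        factor-c c∉P c≢a = begin
          suc N * b c     ≤⟨ *-monoʳ-≤ (suc N) (≤-trans (count-mono (spoilerValue? a c c) ext? (λ (_ , _ , ext) → ext refl) values)
                                                         extreme-values) ⟩
          suc N * 2       ≤⟨ 2[N+1]≤6·interior ⟩
          6 * interior    ≤⟨ *-monoʳ-≤ 6 (interior≤g c c∉P c≢a) ⟩
          6 * g c         ∎
          where open ≤-Reasoning

        by-cases : Dec (Distinct a c) → suc N * count (spoiler? a c) Av ≤ 6 ^ n * length Av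
        by-cases (no ¬distinct) = ≤-trans (≤-reflexive (trans (cong (suc N *_) (count-none (spoiler? a c) (λ _ → ¬distinct ∘ proj₁) Av))
          (*-zeroʳ (suc N)))) z≤n
        by-cases (yes (_ , c∉P , c≢a)) = begin
          suc N * count (spoiler? a c) Av
            ≤⟨ *-monoʳ-≤ (suc N) (≤-trans (count-filter (addable? (withZ ws)) (spoiler? a c) (allVecs N n))
                 (count-mono (spoiler? a c) (coordinatewise? (spoilerValue? a c)) proj₂ (allVecs N n))) ⟩
          suc N * count (coordinatewise? (spoilerValue? a c)) (allVecs N n)
            ≡⟨ cong (suc N *_) (count-coordinatewise n (spoilerValue? a c)) ⟩
          suc N * ∏ n b
            ≤⟨ ∏-compare n 6 (suc N) b g c factor (factor-c c∉P c≢a) ⟩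
          6 ^ n * ∏ n g
            ≡⟨ cong (6 ^ n *_) (sym (count-coordinatewise n (goodValue? a))) ⟩
          6 ^ n * count (coordinatewise? (goodValue? a)) (allVecs N n)
            ≤⟨ *-monoʳ-≤ (6 ^ n) (count-mono (coordinatewise? (goodValue? a)) (addable? (withZ ws))
                                  (λ {x} → good-addable a x) (allVecs N n)) ⟩
          6 ^ n * length Av
            ∎
          where open ≤-Reasoning

      doublyExtreme-bound : suc N * count doublyExtreme? Av ≤ n * (n * (6 ^ n * length Av))
      doublyExtreme-bound = begin
        suc N * count doublyExtreme? Av
          ≤⟨ *-monoʳ-≤ (suc N) (union-bound doublyExtreme? spoilerAt? (allFin n) Av
               (All.map (λ {x} addable de → in-allFin (spoiler-cover x addable de)) (all-filter (addable? (withZ ws)) (allVecs N n)))) ⟩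
        suc N * sum (map (λ a → count (spoilerAt? a) Av) (allFin n))
          ≤⟨ sum-bound (allFin n) _ (suc N) _ per-a ⟩
        length (allFin n) * (n * (6 ^ n * length Av))
          ≡⟨ cong (_* (n * (6 ^ n * length Av))) (length-tabulate {n = n} (λ c → c)) ⟩
        n * (n * (6 ^ n * length Av))
          ∎
        where
        open ≤-Reasoning
        SpoilerAt : Fin n → Cube N n → Set
        SpoilerAt a x = Σ (Fin n) λ c → Spoiler a c x
        spoilerAt? : ∀ a x → Dec (SpoilerAt a x)
        spoilerAt? a x = any? (λ c → spoiler? a c x)
        in-allFin : ∀ {R : Fin n → Set} → Σ (Fin n) R → Any R (allFin n)
        in-allFin (a , r) = Any.map (λ { refl → r }) (∈-allFin a)
        per-a : ∀ a → suc N * count (spoilerAt? a) Av ≤ n * (6 ^ n * length Av)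
        per-a a = ≤-trans (*-monoʳ-≤ (suc N) (union-bound (spoilerAt? a) (spoiler? a) (allFin n) Av (All.tabulate (λ _ → in-allFin))))
          (≤-trans (sum-bound (allFin n) _ (suc N) _ (spoiler-bound a))
                   (≤-reflexive (cong (_* (6 ^ n * length Av)) (length-tabulate {n = n} (λ c → c)))))

    completion-reachable : ∀ {S Q} → Completion S Q → Reachable S → Reachable Q × Maximal Q
    completion-reachable = completion-good 0≢1 Reachable reachable-step

    completion-size : ∀ Q → Completion (z ∷ []) Q → length I + 1 ≤ length Q
    completion-size Q completion with completion-reachable completion ([] , refl , [])
    ... | (ws , refl , separated) , maximal =
      ≤-trans (+-monoˡ-≤ 1 (maximal-size ws maximal separated)) (≤-reflexive (sym (length-withZ ws)))

    minimal-completion : ∃[ Q ] (Completion (z ∷ []) Q × length Q ≡ length I + 1)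
    minimal-completion with greedy (length I) [] [] invariant-start (count-≤-length _ I)
    ... | Q , completion , bound = Q , completion , ≤-antisym bound (completion-size Q completion)

    expected-lower : ι (length I + 1) ℚ.≤ expected (z ∷ [])
    expected-lower = expected-≥ 0≢1 Reachable reachable-step (ι (length I + 1)) final-size
      (suc N ^ n) (z ∷ []) ([] , refl , []) enough-fuel
      where
      final-size : ∀ {S} → Reachable S → Maximal S → ι (length I + 1) ℚ.≤ lengthℚ S
      final-size (ws , refl , separated) maximal =
        ι-mono (≤-trans (+-monoˡ-≤ 1 (maximal-size ws maximal separated)) (≤-reflexive (sym (length-withZ ws))))
      enough-fuel : length (available (z ∷ [])) ≤ suc N ^ n
      enough-fuel = ≤-trans (count-≤-length (addable? (z ∷ [])) (allVecs N n)) (≤-reflexive (length-allVecs n))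

    -- With δ = 2^n n² 6^n / (N + 1), the expected final size from
    -- a packing of l cubes with r unused coordinates is at most l + r + r δ:
    -- a non-doubly-extreme cube uses up one coordinate, while doubly extreme
    -- cubes (a fraction ≤ n² 6^n/(N + 1)) lead to at most 2^n cubes in total.
    δ : ℚ
    δ = ι (K n) ℚ.* inv N

    0≤δ : 0ℚ ℚ.≤ δ
    0≤δ = 0≤* (0≤ι (K n)) (0≤inv N)

    Φ : ℕ → ℕ → ℚ
    Φ l r = ι (l + r) ℚ.+ ι r ℚ.* δ

    Φ-mono : ∀ {l l′ r r′} → l ≤ l′ → r ≤ r′ → Φ l r ℚ.≤ Φ l′ r′
    Φ-mono l≤l′ r≤r′ = ℚ.+-mono-≤ (ι-mono (+-mono-≤ l≤l′ r≤r′))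
                                  (ℚ.*-monoʳ-≤-nonNeg δ {{ℚ.nonNegative 0≤δ}} (ι-mono r≤r′))

    length≤Φ : ∀ l r → ι l ℚ.≤ Φ l r
    length≤Φ l r = ℚ.≤-trans (ℚ.≤-reflexive (sym Φl0≡ιl)) (Φ-mono {l} {l} {0} {r} ≤-refl z≤n)
      where
      Φl0≡ιl : Φ l 0 ≡ ι l
      Φl0≡ιl = trans (cong (ι (l + 0) ℚ.+_) (ℚ.*-zeroˡ δ)) (trans (ℚ.+-identityʳ _) (cong ι (+-identityʳ l)))

    -- Φ (l + 1) r + δ = Φ l (r + 1): using up a coordinate trades one δ for one cube.
    Φ-step : ∀ l r → Φ (suc l) r ℚ.+ δ ≡ Φ l (suc r)
    Φ-step l r = begin
      (ι (suc l + r) ℚ.+ ι r ℚ.* δ) ℚ.+ δ   ≡⟨ ℚ.+-assoc (ι (suc l + r)) (ι r ℚ.* δ) δ ⟩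
      ι (suc l + r) ℚ.+ (ι r ℚ.* δ ℚ.+ δ)   ≡⟨ cong₂ ℚ._+_ (cong ι (sym (+-suc l r)))
                                                            (trans (ℚ.+-comm _ δ) (sym (ι-suc-* r δ))) ⟩
      ι (l + suc r) ℚ.+ ι (suc r) ℚ.* δ     ∎
      where open ≡-Reasoning

    -- Doubly extreme cubes contribute at most 2^n each, i.e. at most δ per available cube.
    spoilers-contribution : ∀ s L → suc N * s ≤ n * (n * (6 ^ n * L)) → ι s ℚ.* ι (2 ^ n) ℚ.≤ ι L ℚ.* δ
    spoilers-contribution s L bound = begin
      ι s ℚ.* ι (2 ^ n)                         ≡⟨ sym (ι-* s (2 ^ n)) ⟩
      ι (s * 2 ^ n)                             ≡⟨ sym (ℚ.*-identityʳ _) ⟩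
      ι (s * 2 ^ n) ℚ.* 1ℚ                      ≡⟨ cong (ι (s * 2 ^ n) ℚ.*_) (sym (ι*inv N)) ⟩
      ι (s * 2 ^ n) ℚ.* (ι (suc N) ℚ.* inv N)   ≡⟨ sym (ℚ.*-assoc (ι (s * 2 ^ n)) (ι (suc N)) (inv N)) ⟩
      (ι (s * 2 ^ n) ℚ.* ι (suc N)) ℚ.* inv N   ≡⟨ cong (ℚ._* inv N) (sym (ι-* (s * 2 ^ n) (suc N))) ⟩
      ι (s * 2 ^ n * suc N) ℚ.* inv N           ≤⟨ ℚ.*-monoʳ-≤-nonNeg (inv N) {{ℚ.nonNegative (0≤inv N)}} (ι-mono in-ℕ) ⟩
      ι (L * K n) ℚ.* inv N                       ≡⟨ cong (ℚ._* inv N) (ι-* L (K n)) ⟩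
      (ι L ℚ.* ι (K n)) ℚ.* inv N                   ≡⟨ ℚ.*-assoc (ι L) (ι (K n)) (inv N) ⟩
      ι L ℚ.* δ                                 ∎
      where
      open ℚ.≤-Reasoning
      reorder₁ : ∀ s M t → s * M * t ≡ M * (t * s)
      reorder₁ = solve-∀
      reorder₂ : ∀ M n x L → M * (n * (n * (x * L))) ≡ L * (M * (n * (n * x)))
      reorder₂ = solve-∀
      in-ℕ : s * 2 ^ n * suc N ≤ L * K n
      in-ℕ = ≤-trans (≤-reflexive (reorder₁ s (2 ^ n) (suc N)))
        (≤-trans (*-monoʳ-≤ (2 ^ n) bound) (≤-reflexive (reorder₂ (2 ^ n) n (6 ^ n) L)))

    expected-upper-from : ∀ f P ws → Invariant P ws → AllPairs NonOverlapping (withZ ws) →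
      expectedFuel f (withZ ws) ℚ.≤ Φ (length (withZ ws)) (remaining P)
    expected-upper-from zero    P ws inv pairwise = length≤Φ (length (withZ ws)) (remaining P)
    expected-upper-from (suc f) P ws inv pairwise =
      step-≤ 0≢1 f (withZ ws) _ (λ _ → length≤Φ l (remaining P)) (average (remaining P) refl)
      where
      open Spoilers inv
      l : ℕ
      l = length (withZ ws)
      E : Cube N n → ℚ
      E w = expectedFuel f (w ∷ withZ ws)

      at-most-2^n : ∀ w → Addable (withZ ws) w → E w ℚ.≤ ι (2 ^ n)
      at-most-2^n w addable = expected-≤ 0≢1 (AllPairs NonOverlapping) (λ pairwise addable → addable ∷ pairwise)
        (ι (2 ^ n)) (λ pairwise → ι-mono (packing-bound _ pairwise)) f (w ∷ withZ ws) (addable ∷ pairwise)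

      average : ∀ r → remaining P ≡ r → sumℚ (map E Av) ℚ.≤ ι (length Av) ℚ.* Φ l r
      -- With no coordinate left, nothing is addable.
      average zero    none  = sum-≤ E (Φ l 0) Av (All.map (λ {w} addable →
        contradiction (subst (0 <_) none (remaining-pos {w = w} inv addable)) λ ()) (available-addable 0≢1 _))
      average (suc r) r≡1+r = begin
        sumℚ (map E Av)                                       ≤⟨ sum-split E doublyExtreme? U (ι (2 ^ n)) 0≤U Av
                                                                 (All.map (λ {w} addable → (λ _ → at-most-2^n w addable) , single-step w addable)
                                                                          (available-addable 0≢1 _)) ⟩
        ι L ℚ.* U ℚ.+ ι (count doublyExtreme? Av) ℚ.* ι (2 ^ n)
                                                              ≤⟨ ℚ.+-monoʳ-≤ (ι L ℚ.* U) (spoilers-contribution (count doublyExtreme? Av) L doublyExtreme-bound) ⟩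
        ι L ℚ.* U ℚ.+ ι L ℚ.* δ                               ≡⟨ sym (ℚ.*-distribˡ-+ (ι L) U δ) ⟩
        ι L ℚ.* (U ℚ.+ δ)                                     ≡⟨ cong (ι L ℚ.*_) (Φ-step l r) ⟩
        ι L ℚ.* Φ l (suc r)                                   ∎
        where
        open ℚ.≤-Reasoning
        L : ℕ
        L = length Av
        U : ℚ
        U = Φ (suc l) r
        0≤U : 0ℚ ℚ.≤ U
        0≤U = ℚ.≤-trans (0≤ι (suc l)) (length≤Φ (suc l) r)
        -- A cube that is not doubly extreme uses up one coordinate.
        single-step : ∀ w → Addable (withZ ws) w → ¬ DoublyExtreme w → E w ℚ.≤ U
        single-step w addable notDE with addable⇒separated ws {w} addable
        ... | i , e = ℚ.≤-trans (expected-upper-from f (i ∷ P) (w ∷ ws) invariant-step (addable ∷ pairwise))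
                        (Φ-mono {suc l} {suc l} ≤-refl (≤-pred (subst (remaining (i ∷ P) <_) r≡1+r remaining-step)))
          where
          single : SingleExtreme P w i
          single c c∉P ext with c ≟ i
          ... | yes c≡i = c≡i
          ... | no  c≢i = contradiction (c , i , c≢i , c∉P , separated-fresh P w (addable⇒agree inv w addable) e , ext , Extreme⇒Extˡ e)
                                        notDE
          open Step {w = w} inv addable e single

    expected-upper : expected (z ∷ []) ℚ.≤ ι (length I + 1) ℚ.+ ι (n * K n) ℚ.* inv N
    expected-upper = begin
      expected (z ∷ [])                          ≤⟨ expected-upper-from (suc N ^ n) [] [] invariant-start ([] ∷ []) ⟩
      Φ 1 (remaining [])                         ≤⟨ Φ-mono {1} {1} ≤-refl (count-≤-length _ I) ⟩
      ι (1 + length I) ℚ.+ ι (length I) ℚ.* δ    ≤⟨ ℚ.+-mono-≤ (ℚ.≤-reflexive (cong ι (+-comm 1 (length I))))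
                                                      (ℚ.*-monoʳ-≤-nonNeg δ {{ℚ.nonNegative 0≤δ}} (ι-mono |I|≤n)) ⟩
      ι (length I + 1) ℚ.+ ι n ℚ.* δ             ≡⟨ cong (ι (length I + 1) ℚ.+_) (trans (sym (ℚ.*-assoc (ι n) (ι (K n)) (inv N)))
                                                      (cong (ℚ._* inv N) (sym (ι-* n (K n))))) ⟩
      ι (length I + 1) ℚ.+ ι (n * K n) ℚ.* inv N ∎
      where
      open ℚ.≤-Reasoning
      |I|≤n : length I ≤ n
      |I|≤n = ≤-trans (count-≤-length _ (allFin n)) (≤-reflexive (length-tabulate {n = n} (λ i → i)))

    expected-deviation : ℚ.∣ expected (z ∷ []) ℚ.- ι (length I + 1) ∣ ℚ.≤ ι (n * K n) ℚ.* inv N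
    expected-deviation = ∣-∣-bound expected-lower expected-upper

open import Defs
open import Data.Nat using (ℕ; suc; _≤_; _+_)
open import Data.List using (List; _∷_; []; length)
open import Data.Product using (Σ; ∃-syntax; _×_; _,_)
open import Data.Integer using (+_)
open import Data.Rational as ℚ using (ℚ)
open import Relation.Binary.PropositionalEquality using (_≡_)
open import Data.Nat using (_*_; s≤s)
open RationalArith using (ι)
open FirstCube using (K; minimal-completion; completion-size; expected-deviation)

lemma2 : ∀ (n : ℕ) → 1 ≤ n →
    (∀ (N : ℕ) → 2 ≤ N → (z₁ : Cube N n) →
      (∃[ Q ] (Completion (z₁ ∷ []) Q × length Q ≡ length (Iset z₁) + 1))
      × (∀ Q → Completion (z₁ ∷ []) Q → length (Iset z₁) + 1 ≤ length Q))
    × (∃[ C ] (∀ (N : ℕ) → 2 ≤ N → (z₁ : Cube N n) →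
         ℚ.∣ expected (z₁ ∷ []) ℚ.- ((+ (length (Iset z₁) + 1)) ℚ./ 1) ∣
           ℚ.≤ C ℚ.* ((+ 1) ℚ./ suc N)))
lemma2 n _ =
  (λ { _ (s≤s (s≤s _)) z → minimal-completion z , completion-size z }) ,
  (ι (n * K n) , λ { _ (s≤s (s≤s _)) z → expected-deviation z })
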